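{- Let $T$ be a bidirected tree rooted at some vertex $z$, and let $Q$ be a branch of $T$. Let $r_0$ be a request that contains an arc of $Q$, and let $r$ be a unimodal request that shares no arc with $Q$. Then $r$ and $r_0$ interfere.
   Context: A bidirected tree $T$ is a digraph obtained from a finite undirected tree by replacing each edge $uv$ by the two arcs $(u,v)$ and $(v,u)$. A request in $T$ is a directed path in $T$ with at least one arc. For a directed path $r$, $s_r$ is its first vertex, $t_r$ its last vertex, $s_r^+$ its second vertex, $t_r^-$ its penultimate vertex; its emission arc is $(s_r,s_r^+)$ and its reception arc is $(t_r^-,t_r)$. $T[x,y]$ denotes the unique directed path from $x$ to $y$ in $T$. A request $r$ interferes on $r'$ if $T[s_r,t_{r'}]$ has first arc the emission arc of $r$ and last arc the reception arc of $r'$; two requests interfere if one interferes on the other. When $T$ is rooted at $z$, an arc is converging if directed towards $z$ and diverging otherwise; a directed path is converging (resp. diverging) if all its arcs are converging (resp. diverging), and unimodal otherwise. A branch of the rooted tree is the bidirected path (both arc directions) between the root $z$ and a leaf. -}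

module Defs where

open import Data.Nat using (ℕ; suc)
open import Data.Fin using (Fin)
open import Data.List using (List; []; _∷_; _∷ʳ_)
open import Data.List.Relation.Unary.All using (All)
open import Data.List.Relation.Unary.Unique.Propositional using (Unique)
open import Data.List.Membership.Propositional using (_∈_)
open import Data.Product using (Σ; _×_; _,_; ∃; ∃-syntax)
open import Data.Sum using (_⊎_)
open import Relation.Binary.PropositionalEquality using (_≡_; _≢_)
open import Relation.Nullary using (¬_)

-- The depth function certifies acyclicity / connectedness: every non-root vertex
-- has a parent of depth one less, so following parents reaches the root.
-- (`parent root` is irrelevant and ignored.)  Every finite rooted tree arises this way.
record RootedTree (n : ℕ) : Set where
  field
    root        : Fin n
    parent      : Fin n → Fin n
    depth       : Fin n → ℕ
    depth-root  : depth root ≡ 0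
    depth-par   : ∀ v → v ≢ root → suc (depth (parent v)) ≡ depth v

module _ {n : ℕ} (T : RootedTree n) where
  open RootedTree T

  V : Set
  V = Fin n

  Arc : Set
  Arc = V × V

  Converging : Arc → Set
  Converging (u , v) = u ≢ root × v ≡ parent u

  Diverging : Arc → Set
  Diverging (u , v) = v ≢ root × u ≡ parent v

  IsArc : Arc → Set
  IsArc a = Converging a ⊎ Diverging a

  arcs : List V → List Arc
  arcs (x ∷ y ∷ rest) = (x , y) ∷ arcs (y ∷ rest)
  arcs _              = []

  IsDirPath : List V → Set
  IsDirPath p = All IsArc (arcs p) × Unique p

  IsRequest : List V → Set
  IsRequest p = IsDirPath p × arcs p ≢ []

  -- `a` is the first arc of p (for a request: its emission arc)
  FirstArc : List V → Arc → Set
  FirstArc p a = ∃[ rest ] arcs p ≡ a ∷ rest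

  -- `a` is the last arc of p (for a request: its reception arc)
  LastArc : List V → Arc → Set
  LastArc p a = ∃[ ini ] arcs p ≡ ini ∷ʳ a

  -- r interferes on r' : the directed path T[s_r, t_r'] (the unique directed path
  -- starting with some arc out of s_r and ending with some arc into t_r') has
  -- as first arc the emission arc of r and as last arc the reception arc of r'.
  -- (Any directed path whose first arc leaves s_r and last arc enters t_r' is
  -- T[s_r, t_r'], by uniqueness of paths in a tree.)
  InterferesOn : List V → List V → Set
  InterferesOn r r' =
    Σ (List V) λ p → IsDirPath p
      × (∃[ a ] FirstArc r a × FirstArc p a)
      × (∃[ b ] LastArc r' b × LastArc p b)

  Interfere : List V → List V → Set
  Interfere r r' = InterferesOn r r' ⊎ InterferesOn r' r

  ConvergingPath : List V → Set
  ConvergingPath p = All Converging (arcs p)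

  DivergingPath : List V → Set
  DivergingPath p = All Diverging (arcs p)

  Unimodal : List V → Set
  Unimodal p = ¬ ConvergingPath p × ¬ DivergingPath p

  IsLeaf : V → Set
  IsLeaf ℓ = ∀ v → v ≢ root → parent v ≢ ℓ

  -- q is the directed path from the root to a leaf; the branch Q is the
  -- bidirected path consisting of the arcs of q and their reverses.
  IsBranchPath : List V → Set
  IsBranchPath q = IsDirPath q × (∃[ rest ] q ≡ root ∷ rest)
                   × (∃[ ℓ ] IsLeaf ℓ × ∃[ ini ] q ≡ ini ∷ʳ ℓ)

  InBranch : List V → Arc → Set
  InBranch q (u , v) = (u , v) ∈ arcs q ⊎ (v , u) ∈ arcs q

-- A directed path in a tree climbs from its source to the last common ancestor of
-- its ends and then descends, so T[s_r, t_r′] starts like r and ends like r′ as soon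
-- as, seen from s_r, t_r′ lies in the direction of t_r and, seen from t_r′, s_r lies
-- in the direction of s_r′.  An arc of r₀ on the branch puts a branch vertex y above
-- exactly one end of r₀.  As r avoids the branch, y is above both ends of r or
-- neither; as r is unimodal, no end of r is above the other or above a branch vertex.
-- In each of the four cases both pairs of directions agree: they either both point
-- to the parent or both into the subtree of y.
module Submission where

open import Defs
open import Data.Nat using (ℕ; zero; suc; _≤_; _<_)
open import Data.Nat.Properties using (≤-refl; ≤-reflexive; ≤-<-trans; <⇒≤; <⇒≱; suc-injective; 1+n≢0)
open import Data.Fin.Properties using (_≟_)
open import Data.List using (List; []; _∷_)
open import Data.List.Relation.Unary.All as All using (All; []; _∷_)
open import Data.List.Relation.Unary.Any using (here; there)
open import Data.List.Relation.Unary.AllPairs using ([]; _∷_)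
open import Data.List.Membership.Propositional using (_∈_)
open import Data.Product using (Σ; _×_; _,_; proj₁; proj₂; swap; ∃-syntax)
open import Data.Sum using (_⊎_; inj₁; inj₂; [_,_])
open import Data.Empty using (⊥-elim)
open import Relation.Binary.PropositionalEquality using (_≡_; _≢_; refl; sym; trans; cong; subst; ≢-sym; module ≡-Reasoning)
open import Relation.Nullary using (¬_; Dec; yes; no)
open import Function using (_∘_; case_of_)

lastOr : {A : Set} → A → List A → A
lastOr d []      = d
lastOr d (x ∷ l) = lastOr x l

module _ {n : ℕ} (T : RootedTree n) where
  open RootedTree T

  depth-parent< : ∀ {x} → x ≢ root → depth (parent x) < depth x
  depth-parent< {x} x≢root = ≤-reflexive (depth-par x x≢root)

  parent-induction : (P : V T → Set) → (∀ x → (x ≢ root → P (parent x)) → P x) → ∀ x → P x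
  parent-induction P step x = go (depth x) x refl
    where
    go : ∀ k x → depth x ≡ k → P x
    go zero    x d = step x λ x≢root → ⊥-elim (1+n≢0 (trans (depth-par x x≢root) d))
    go (suc k) x d = step x λ x≢root → go k (parent x) (suc-injective (trans (depth-par x x≢root) d))

  data _≼_ (y : V T) : V T → Set where
    ≼-refl : y ≼ y
    ≼-step : ∀ {x} → x ≢ root → y ≼ parent x → y ≼ x

  ≼-trans : ∀ {z y x} → z ≼ y → y ≼ x → z ≼ x
  ≼-trans z≼y ≼-refl            = z≼y
  ≼-trans z≼y (≼-step x≢root y≼px) = ≼-step x≢root (≼-trans z≼y y≼px)

  parent≼ : ∀ {x} → x ≢ root → parent x ≼ x
  parent≼ x≢root = ≼-step x≢root ≼-refl

  ≼⇒depth≤ : ∀ {y x} → y ≼ x → depth y ≤ depth x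
  ≼⇒depth≤ ≼-refl            = ≤-refl
  ≼⇒depth≤ (≼-step x≢root y≼px) = <⇒≤ (≤-<-trans (≼⇒depth≤ y≼px) (depth-parent< x≢root))

  ≼-parent : ∀ {y x} → y ≼ x → y ≢ x → y ≼ parent x
  ≼-parent ≼-refl          y≢x = ⊥-elim (y≢x refl)
  ≼-parent (≼-step _ y≼px) _   = y≼px

  ≼∧depth≥⇒≡ : ∀ {y x} → y ≼ x → depth x ≤ depth y → y ≡ x
  ≼∧depth≥⇒≡ ≼-refl            _ = refl
  ≼∧depth≥⇒≡ (≼-step x≢root y≼px) dx≤dy = ⊥-elim (<⇒≱ (≤-<-trans (≼⇒depth≤ y≼px) (depth-parent< x≢root)) dx≤dy)

  ⋠parent : ∀ {x} → x ≢ root → ¬ x ≼ parent x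
  ⋠parent x≢root x≼px = <⇒≱ (depth-parent< x≢root) (≼⇒depth≤ x≼px)

  ≼-connex : ∀ {y z x} → y ≼ x → z ≼ x → y ≼ z ⊎ z ≼ y
  ≼-connex ≼-refl          z≼x             = inj₂ z≼x
  ≼-connex y≼x             ≼-refl          = inj₁ y≼x
  ≼-connex (≼-step _ y≼px) (≼-step _ z≼px) = ≼-connex y≼px z≼px

  ≼root⇒≡ : ∀ {y} → y ≼ root → y ≡ root
  ≼root⇒≡ ≼-refl           = refl
  ≼root⇒≡ (≼-step root≢root _) = ⊥-elim (root≢root refl)

  root≼ : ∀ x → root ≼ x
  root≼ = parent-induction (root ≼_) λ where
    x ih → case x ≟ root of λ where
      (yes refl)  → ≼-refl
      (no x≢root) → ≼-step x≢root (ih x≢root)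

  _≼?_ : ∀ y x → Dec (y ≼ x)
  y ≼? x = parent-induction (λ x → Dec (y ≼ x)) decide x
    where
    decide : ∀ x → (x ≢ root → Dec (y ≼ parent x)) → Dec (y ≼ x)
    decide x ih with y ≟ x | x ≟ root
    ... | yes refl | _          = yes ≼-refl
    ... | no y≢x   | yes refl   = no λ y≼r → y≢x (≼root⇒≡ y≼r)
    ... | no y≢x   | no x≢root with ih x≢root
    ...   | yes y≼px = yes (≼-step x≢root y≼px)
    ...   | no y⋠px  = no λ y≼x → y⋠px (≼-parent y≼x y≢x)

  ⋠⇒≢ : ∀ {y x} → ¬ y ≼ x → y ≢ x
  ⋠⇒≢ y⋠x refl = y⋠x ≼-refl

  arc-ends : ∀ {u v} (p : List (V T)) → (u , v) ∈ arcs T p → u ∈ p × v ∈ p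
  arc-ends (a ∷ b ∷ p) (here refl) = here refl , there (here refl)
  arc-ends (a ∷ b ∷ p) (there uv∈) = let (u∈ , v∈) = arc-ends (b ∷ p) uv∈ in there u∈ , there v∈

  -- The arcs of p are exactly those of T[a, b]: it climbs from a to the last
  -- common ancestor of a and b, then descends to b.
  record Route (a b : V T) (p : List (V T)) : Set where
    field
      up-arc     : ∀ {u v} → (u , v) ∈ arcs T p → Converging T (u , v) → u ≼ a × ¬ u ≼ b
      down-arc   : ∀ {u v} → (u , v) ∈ arcs T p → Diverging T (u , v) → v ≼ b × ¬ v ≼ a
      up-arc-∈   : ∀ {y} → y ≼ a → ¬ y ≼ b → (y , parent y) ∈ arcs T p
      down-arc-∈ : ∀ {y} → y ≼ b → ¬ y ≼ a → (parent y , y) ∈ arcs T p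
  open Route

  route-[] : ∀ a → Route a a (a ∷ [])
  route-[] a = record
    { up-arc = λ () ; down-arc = λ ()
    ; up-arc-∈ = λ y≼a y⋠a → ⊥-elim (y⋠a y≼a) ; down-arc-∈ = λ y≼a y⋠a → ⊥-elim (y⋠a y≼a) }

  route-∷-up : ∀ {a b l} → a ≢ root → All (a ≢_) (parent a ∷ l) →
               Route (parent a) b (parent a ∷ l) → Route a b (a ∷ parent a ∷ l)
  route-∷-up {a} {b} {l} a≢root a∉ R = record
    { up-arc = up ; down-arc = down ; up-arc-∈ = up-∈ ; down-arc-∈ = down-∈ }
    where
    a≢ : ∀ {v} → v ∈ parent a ∷ l → a ≢ v
    a≢ = All.lookup a∉
    up : ∀ {u v} → (u , v) ∈ arcs T (a ∷ parent a ∷ l) → Converging T (u , v) → u ≼ a × ¬ u ≼ b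
    up (here refl) _ = ≼-refl , λ a≼b →
      a≢ (proj₂ (arc-ends _ (down-arc-∈ R a≼b (⋠parent a≢root)))) refl
    up (there uv∈) c = let (u≼pa , u⋠b) = up-arc R uv∈ c in ≼-trans u≼pa (parent≼ a≢root) , u⋠b
    down : ∀ {u v} → (u , v) ∈ arcs T (a ∷ parent a ∷ l) → Diverging T (u , v) → v ≼ b × ¬ v ≼ a
    down (here refl) (pa≢root , a≡ppa) =
      ⊥-elim (⋠parent a≢root (subst (_≼ parent a) (sym a≡ppa) (parent≼ pa≢root)))
    down (there uv∈) d = let (v≼b , v⋠pa) = down-arc R uv∈ d in
      v≼b , λ v≼a → v⋠pa (≼-parent v≼a λ { refl → a≢ (proj₂ (arc-ends _ uv∈)) refl })
    up-∈ : ∀ {y} → y ≼ a → ¬ y ≼ b → (y , parent y) ∈ arcs T (a ∷ parent a ∷ l)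
    up-∈ {y} y≼a y⋠b with y ≟ a
    ... | yes refl = here refl
    ... | no y≢a   = there (up-arc-∈ R (≼-parent y≼a y≢a) y⋠b)
    down-∈ : ∀ {y} → y ≼ b → ¬ y ≼ a → (parent y , y) ∈ arcs T (a ∷ parent a ∷ l)
    down-∈ y≼b y⋠a = there (down-arc-∈ R y≼b λ y≼pa → y⋠a (≼-trans y≼pa (parent≼ a≢root)))

  route-∷-down : ∀ {c b l} → c ≢ root → All (parent c ≢_) (c ∷ l) →
                 Route c b (c ∷ l) → Route (parent c) b (parent c ∷ c ∷ l)
  route-∷-down {c} {b} {l} c≢root pc∉ R = record
    { up-arc = up ; down-arc = down ; up-arc-∈ = up-∈ ; down-arc-∈ = down-∈ }
    where
    pc≢ : ∀ {v} → v ∈ c ∷ l → parent c ≢ v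
    pc≢ = All.lookup pc∉
    up : ∀ {u v} → (u , v) ∈ arcs T (parent c ∷ c ∷ l) → Converging T (u , v) → u ≼ parent c × ¬ u ≼ b
    up (here refl) (pc≢root , c≡ppc) =
      ⊥-elim (⋠parent c≢root (subst (_≼ parent c) (sym c≡ppc) (parent≼ pc≢root)))
    up (there uv∈) (u≢root , v≡pu) = let (u≼c , u⋠b) = up-arc R uv∈ (u≢root , v≡pu) in
      ≼-parent u≼c (λ { refl → pc≢ (proj₂ (arc-ends _ uv∈)) (sym v≡pu) }) , u⋠b
    c≼b : c ≼ b
    c≼b with c ≼? b
    ... | yes c≼b = c≼b
    ... | no c⋠b  = ⊥-elim (pc≢ (proj₂ (arc-ends _ (up-arc-∈ R ≼-refl c⋠b))) refl)
    down : ∀ {u v} → (u , v) ∈ arcs T (parent c ∷ c ∷ l) → Diverging T (u , v) → v ≼ b × ¬ v ≼ parent c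
    down (here refl) _ = c≼b , ⋠parent c≢root
    down (there uv∈) d = let (v≼b , v⋠c) = down-arc R uv∈ d in
      v≼b , λ v≼pc → v⋠c (≼-trans v≼pc (parent≼ c≢root))
    up-∈ : ∀ {y} → y ≼ parent c → ¬ y ≼ b → (y , parent y) ∈ arcs T (parent c ∷ c ∷ l)
    up-∈ y≼pc y⋠b = there (up-arc-∈ R (≼-trans y≼pc (parent≼ c≢root)) y⋠b)
    down-∈ : ∀ {y} → y ≼ b → ¬ y ≼ parent c → (parent y , y) ∈ arcs T (parent c ∷ c ∷ l)
    down-∈ {y} y≼b y⋠pc with y ≟ c
    ... | yes refl = here refl
    ... | no y≢c   = there (down-arc-∈ R y≼b λ y≼c → y⋠pc (≼-parent y≼c y≢c))

  dirPath⇒route : ∀ a l → IsDirPath T (a ∷ l) → Route a (lastOr a l) (a ∷ l)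
  dirPath⇒route a []      _ = route-[] a
  dirPath⇒route a (c ∷ l) ((inj₁ (a≢root , refl) ∷ ok) , (a∉ ∷ uq)) =
    route-∷-up a≢root a∉ (dirPath⇒route (parent a) l (ok , uq))
  dirPath⇒route .(parent c) (c ∷ l) ((inj₂ (c≢root , refl) ∷ ok) , (pc∉ ∷ uq)) =
    route-∷-down c≢root pc∉ (dirPath⇒route c l (ok , uq))

  -- P is the invariant that keeps each prepended vertex fresh.
  PathWith : (V T → Set) → V T → V T → Set
  PathWith P a b = Σ (List (V T)) λ l → IsDirPath T (a ∷ l) × lastOr a l ≡ b × All P (a ∷ l)

  descend : ∀ {y x z} → y ≼ x → PathWith (λ v → x ≼ v × v ≼ z) x z → PathWith (λ v → y ≼ v × v ≼ z) y z
  descend ≼-refl path = path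
  descend {x = x} (≼-step x≢root y≼px) (l , (ok , uq) , last≡ , all@((_ , x≼z) ∷ _)) =
    descend y≼px
      ( x ∷ l
      , ((inj₂ (x≢root , refl) ∷ ok) , (All.map (λ (x≼v , _) → px≢ x≼v) all ∷ uq))
      , last≡
      , ((≼-refl , ≼-trans (parent≼ x≢root) x≼z) ∷ All.map (λ (x≼v , v≼z) → ≼-trans (parent≼ x≢root) x≼v , v≼z) all))
    where
    px≢ : ∀ {v} → x ≼ v → parent x ≢ v
    px≢ x≼v refl = ⋠parent x≢root x≼v

  climb : ∀ {a b} → a ≢ root → ¬ a ≼ b →
          PathWith (λ v → v ≼ parent a ⊎ v ≼ b) (parent a) b → PathWith (λ v → v ≼ a ⊎ v ≼ b) a b
  climb {a} {b} a≢root a⋠b (l , (ok , uq) , last≡ , all) =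
    parent a ∷ l , ((inj₁ (a≢root , refl) ∷ ok) , (All.map a≢ all ∷ uq)) , last≡ ,
    (inj₁ ≼-refl ∷ All.map widen all)
    where
    a≢ : ∀ {v} → v ≼ parent a ⊎ v ≼ b → a ≢ v
    a≢ (inj₁ v≼pa) refl = ⋠parent a≢root v≼pa
    a≢ (inj₂ v≼b)  refl = a⋠b v≼b
    widen : ∀ {v} → v ≼ parent a ⊎ v ≼ b → v ≼ a ⊎ v ≼ b
    widen (inj₁ v≼pa) = inj₁ (≼-trans v≼pa (parent≼ a≢root))
    widen (inj₂ v≼b)  = inj₂ v≼b

  path-between : ∀ a b → Σ (List (V T)) λ l → IsDirPath T (a ∷ l) × lastOr a l ≡ b
  path-between a b =
    let (l , dp , last≡ , _) = parent-induction (λ a → PathWith (λ v → v ≼ a ⊎ v ≼ b) a b) build a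
    in l , dp , last≡
    where
    build : ∀ a → (a ≢ root → PathWith (λ v → v ≼ parent a ⊎ v ≼ b) (parent a) b) →
            PathWith (λ v → v ≼ a ⊎ v ≼ b) a b
    build a ih with a ≼? b
    ... | yes a≼b =
      let (l , dp , last≡ , all) = descend a≼b ([] , ([] , ([] ∷ [])) , refl , ((≼-refl , ≼-refl) ∷ []))
      in l , dp , last≡ , All.map (inj₂ ∘ proj₂) all
    ... | no a⋠b = climb a≢root a⋠b (ih a≢root)
      where
      a≢root : a ≢ root
      a≢root refl = a⋠b (root≼ b)

  -- (b , x) is the first arc of T[b, a]
  StepToward : V T → V T → V T → Set
  StepToward b a x = (Diverging T (b , x) × x ≼ a) ⊎ (Converging T (b , x) × ¬ b ≼ a)

  stepToward-⋠ : ∀ {b a x} → ¬ b ≼ a → StepToward b a x → x ≡ parent b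
  stepToward-⋠ b⋠a (inj₁ ((x≢root , refl) , x≼a)) = ⊥-elim (b⋠a (≼-trans (parent≼ x≢root) x≼a))
  stepToward-⋠ b⋠a (inj₂ ((_ , x≡pb) , _))       = x≡pb

  stepToward-unique : ∀ {b a x x′} → StepToward b a x → StepToward b a x′ → x ≡ x′
  stepToward-unique (inj₁ ((x≢root , refl) , x≼a)) (inj₁ ((x′≢root , b≡px′) , x′≼a)) =
    case ≼-connex x≼a x′≼a of λ where
      (inj₁ x≼x′) → ≼∧depth≥⇒≡ x≼x′ (depth≤ x≢root x′≢root b≡px′)
      (inj₂ x′≼x) → sym (≼∧depth≥⇒≡ x′≼x (depth≤ x′≢root x≢root (sym b≡px′)))
    where
    depth≤ : ∀ {x x′} → x ≢ root → x′ ≢ root → parent x ≡ parent x′ → depth x′ ≤ depth x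
    depth≤ {x} {x′} x≢root x′≢root px≡px′ = ≤-reflexive (begin
      depth x′                ≡⟨ sym (depth-par x′ x′≢root) ⟩
      suc (depth (parent x′)) ≡⟨ cong (suc ∘ depth) (sym px≡px′) ⟩
      suc (depth (parent x))  ≡⟨ depth-par x x≢root ⟩
      depth x                 ∎)
      where open ≡-Reasoning
  stepToward-unique (inj₂ ((_ , x≡pb) , _)) (inj₂ ((_ , x′≡pb) , _)) = trans x≡pb (sym x′≡pb)
  stepToward-unique (inj₁ ((x≢root , refl) , x≼a)) (inj₂ (_ , b⋠a)) =
    ⊥-elim (b⋠a (≼-trans (parent≼ x≢root) x≼a))
  stepToward-unique (inj₂ (_ , b⋠a)) (inj₁ ((x′≢root , refl) , x′≼a)) =
    ⊥-elim (b⋠a (≼-trans (parent≼ x′≢root) x′≼a))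

  stepToward-subtree : ∀ {b a y x} → y ≼ a → ¬ y ≼ b → StepToward b a x → StepToward b y x
  stepToward-subtree {y = y} {x} y≼a y⋠b (inj₁ ((x≢root , refl) , x≼a)) = inj₁ ((x≢root , refl) , x≼y)
    where
    x≼y : x ≼ y
    x≼y with ≼-connex x≼a y≼a | y ≟ x
    ... | inj₁ x≼y | _        = x≼y
    ... | inj₂ _   | yes refl = ≼-refl
    ... | inj₂ y≼x | no y≢x   = ⊥-elim (y⋠b (≼-parent y≼x y≢x))
  stepToward-subtree y≼a y⋠b (inj₂ (c , b⋠a)) = inj₂ (c , λ b≼y → b⋠a (≼-trans b≼y y≼a))

  SameStep : V T → V T → V T → Set
  SameStep b a c = ∀ {x x′} → StepToward b a x → StepToward b c x′ → x ≡ x′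

  sameStep-⋠ : ∀ {b a c} → ¬ b ≼ a → ¬ b ≼ c → SameStep b a c
  sameStep-⋠ b⋠a b⋠c st st′ = trans (stepToward-⋠ b⋠a st) (sym (stepToward-⋠ b⋠c st′))

  sameStep-subtree : ∀ {b a c y} → y ≼ a → y ≼ c → ¬ y ≼ b → SameStep b a c
  sameStep-subtree y≼a y≼c y⋠b st st′ =
    stepToward-unique (stepToward-subtree y≼a y⋠b st) (stepToward-subtree y≼c y⋠b st′)

  first-step : ∀ {a c l b} → IsDirPath T (a ∷ c ∷ l) → lastOr c l ≡ b → StepToward a b c
  first-step {a} {c} {l} dp@((arc ∷ _) , _) refl with arc
  ... | inj₁ up   = inj₂ (up , proj₂ (up-arc (dirPath⇒route a (c ∷ l) dp) (here refl) up))
  ... | inj₂ down = inj₁ (down , proj₁ (down-arc (dirPath⇒route a (c ∷ l) dp) (here refl) down))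

  last-arc : ∀ a c l → ∃[ x ] LastArc T (a ∷ c ∷ l) (x , lastOr c l) × (x , lastOr c l) ∈ arcs T (a ∷ c ∷ l)
  last-arc a c []      = a , ([] , refl) , here refl
  last-arc a c (d ∷ l) =
    let (x , (ini , arcs≡) , x∈) = last-arc c d l in x , ((a , c) ∷ ini , cong ((a , c) ∷_) arcs≡) , there x∈

  last-step : ∀ {a c l b} → IsDirPath T (a ∷ c ∷ l) → lastOr c l ≡ b →
              ∃[ x ] LastArc T (a ∷ c ∷ l) (x , b) × StepToward b a x
  last-step {a} {c} {l} dp refl with last-arc a c l
  ... | x , last , x∈ with All.lookup (proj₁ dp) x∈
  ...   | inj₁ up   = x , last , inj₁ (up , proj₁ (up-arc (dirPath⇒route a (c ∷ l) dp) x∈ up))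
  ...   | inj₂ down = x , last , inj₂ (down , proj₂ (down-arc (dirPath⇒route a (c ∷ l) dp) x∈ down))

  -- The hypotheses say that T[s, t′] leaves s like r and enters t′ like r′.
  interferesOn : ∀ {s c l s′ c′ l′} → IsDirPath T (s ∷ c ∷ l) → IsDirPath T (s′ ∷ c′ ∷ l′) →
                 s ≢ lastOr c′ l′ → SameStep s (lastOr c l) (lastOr c′ l′) → SameStep (lastOr c′ l′) s s′ →
                 InterferesOn T (s ∷ c ∷ l) (s′ ∷ c′ ∷ l′)
  interferesOn {s} {c} {l} {s′} {c′} {l′} dp dp′ s≢t′ same-first same-last
    with path-between s (lastOr c′ l′)
  ... | [] , _ , s≡t′ = ⊥-elim (s≢t′ s≡t′)
  ... | d ∷ p , dp″ , last≡ with last-step dp″ last≡ | last-step dp′ refl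
  ...   | x , x-last , x-step | x′ , x′-last , x′-step =
    s ∷ d ∷ p , dp″ ,
    ((s , c) , (arcs T (c ∷ l) , refl) ,
      subst (λ e → FirstArc T (s ∷ e ∷ p) (s , c)) (same-first (first-step dp refl) (first-step dp″ last≡)) (_ , refl)) ,
    ((x′ , lastOr c′ l′) , x′-last ,
      subst (λ z → LastArc T (s ∷ d ∷ p) (z , lastOr c′ l′)) (same-last x-step x′-step) x-last)

  ancestor⇒diverging : ∀ {a l} → IsDirPath T (a ∷ l) → a ≼ lastOr a l → DivergingPath T (a ∷ l)
  ancestor⇒diverging {a} {l} dp a≼b = All.tabulate arc-diverging
    where
    arc-diverging : ∀ {uv} → uv ∈ arcs T (a ∷ l) → Diverging T uv
    arc-diverging uv∈ with All.lookup (proj₁ dp) uv∈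
    ... | inj₁ up   = let (u≼a , u⋠b) = up-arc (dirPath⇒route a l dp) uv∈ up in ⊥-elim (u⋠b (≼-trans u≼a a≼b))
    ... | inj₂ down = down

  descendant⇒converging : ∀ {a l} → IsDirPath T (a ∷ l) → lastOr a l ≼ a → ConvergingPath T (a ∷ l)
  descendant⇒converging {a} {l} dp b≼a = All.tabulate arc-converging
    where
    arc-converging : ∀ {uv} → uv ∈ arcs T (a ∷ l) → Converging T uv
    arc-converging uv∈ with All.lookup (proj₁ dp) uv∈
    ... | inj₁ up   = up
    ... | inj₂ down = let (v≼b , v⋠a) = down-arc (dirPath⇒route a l dp) uv∈ down in ⊥-elim (v⋠a (≼-trans v≼b b≼a))

  arc-separates : ∀ {a l u v} → IsDirPath T (a ∷ l) → (u , v) ∈ arcs T (a ∷ l) →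
                  (u ≼ a × ¬ u ≼ lastOr a l) ⊎ (v ≼ lastOr a l × ¬ v ≼ a)
  arc-separates {a} {l} dp uv∈ with All.lookup (proj₁ dp) uv∈
  ... | inj₁ up   = inj₁ (up-arc (dirPath⇒route a l dp) uv∈ up)
  ... | inj₂ down = inj₂ (down-arc (dirPath⇒route a l dp) uv∈ down)

  predecessor : ∀ {y} a l → y ∈ a ∷ l → y ≢ a → ∃[ x ] (x , y) ∈ arcs T (a ∷ l)
  predecessor a l       (here y≡a)         y≢a = ⊥-elim (y≢a y≡a)
  predecessor a (c ∷ l) (there (here refl)) _  = a , here refl
  predecessor {y} a (c ∷ l) (there (there y∈)) _ with y ≟ c
  ... | yes refl = a , here refl
  ... | no y≢c   = let (x , xy∈) = predecessor c l (there y∈) y≢c in x , there xy∈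

  module _ {qs : List (V T)} (q-dir : IsDirPath T (root ∷ qs)) where

    branch-parent-arc : ∀ {y} → y ∈ root ∷ qs → y ≢ root → (parent y , y) ∈ arcs T (root ∷ qs)
    branch-parent-arc {y} y∈ y≢root with predecessor root qs y∈ y≢root
    ... | x , xy∈ with All.lookup (proj₁ q-dir) xy∈
    ...   | inj₂ (_ , refl)      = xy∈
    ...   | inj₁ up@(x≢root , _) = ⊥-elim (x≢root (≼root⇒≡ (proj₁ (up-arc (dirPath⇒route root qs q-dir) xy∈ up))))

    branch-≼-closed : ∀ {x y} → x ≼ y → y ∈ root ∷ qs → x ∈ root ∷ qs
    branch-≼-closed ≼-refl             y∈ = y∈
    branch-≼-closed (≼-step y≢root x≼py) y∈ =
      branch-≼-closed x≼py (proj₁ (arc-ends _ (branch-parent-arc y∈ y≢root)))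

    module _ {s c l} (r-dir : IsDirPath T (s ∷ c ∷ l))
             (avoids : ∀ a → a ∈ arcs T (s ∷ c ∷ l) → ¬ InBranch T (root ∷ qs) a) where

      ≼source⇒≼target : ∀ {y} → y ∈ root ∷ qs → y ≼ s → y ≼ lastOr c l
      ≼source⇒≼target {y} y∈ y≼s with y ≼? lastOr c l
      ... | yes y≼t = y≼t
      ... | no y⋠t  = ⊥-elim (avoids _ (up-arc-∈ (dirPath⇒route s (c ∷ l) r-dir) y≼s y⋠t)
                               (inj₂ (branch-parent-arc y∈ λ { refl → y⋠t (root≼ _) })))

      ≼target⇒≼source : ∀ {y} → y ∈ root ∷ qs → y ≼ lastOr c l → y ≼ s
      ≼target⇒≼source {y} y∈ y≼t with y ≼? s
      ... | yes y≼s = y≼s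
      ... | no y⋠s  = ⊥-elim (avoids _ (down-arc-∈ (dirPath⇒route s (c ∷ l) r-dir) y≼t y⋠s)
                               (inj₁ (branch-parent-arc y∈ λ { refl → y⋠s (root≼ _) })))

      unimodal-interferes : ∀ {s₀ c₀ l₀} → IsDirPath T (s₀ ∷ c₀ ∷ l₀) →
                            (∃[ a ] a ∈ arcs T (s₀ ∷ c₀ ∷ l₀) × InBranch T (root ∷ qs) a) →
                            Unimodal T (s ∷ c ∷ l) → Interfere T (s ∷ c ∷ l) (s₀ ∷ c₀ ∷ l₀)
      unimodal-interferes {s₀} {c₀} {l₀} r₀-dir ((u , v) , uv∈ , uv∈Q) (not-converging , not-diverging) =
        [ (λ (u≼s₀ , u⋠t₀) → leaving  (proj₁ ends) u≼s₀ u⋠t₀)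
        , (λ (v≼t₀ , v⋠s₀) → entering (proj₂ ends) v≼t₀ v⋠s₀)
        ] (arc-separates r₀-dir uv∈)
        where
        t t₀ : V T
        t  = lastOr c l
        t₀ = lastOr c₀ l₀
        ends : u ∈ root ∷ qs × v ∈ root ∷ qs
        ends = [ arc-ends _ , swap ∘ arc-ends _ ] uv∈Q
        s⋠t : ¬ s ≼ t
        s⋠t = not-diverging ∘ ancestor⇒diverging r-dir
        t⋠s : ¬ t ≼ s
        t⋠s = not-converging ∘ descendant⇒converging r-dir
        s⋠branch : ∀ {y} → y ∈ root ∷ qs → ¬ s ≼ y
        s⋠branch y∈ s≼y = s⋠t (≼source⇒≼target (branch-≼-closed s≼y y∈) ≼-refl)
        t⋠branch : ∀ {y} → y ∈ root ∷ qs → ¬ t ≼ y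
        t⋠branch y∈ t≼y = t⋠s (≼target⇒≼source (branch-≼-closed t≼y y∈) ≼-refl)

        leaving : ∀ {y} → y ∈ root ∷ qs → y ≼ s₀ → ¬ y ≼ t₀ → Interfere T (s ∷ c ∷ l) (s₀ ∷ c₀ ∷ l₀)
        leaving {y} y∈ y≼s₀ y⋠t₀ with y ≼? t
        ... | yes y≼t = inj₁ (interferesOn r-dir r₀-dir (⋠⇒≢ s⋠t₀) (sameStep-⋠ s⋠t s⋠t₀)
                                (sameStep-subtree y≼s y≼s₀ y⋠t₀))
          where
          y≼s : y ≼ s
          y≼s = ≼target⇒≼source y∈ y≼t
          s⋠t₀ : ¬ s ≼ t₀
          s⋠t₀ s≼t₀ = y⋠t₀ (≼-trans y≼s s≼t₀)
        ... | no y⋠t = inj₂ (interferesOn r₀-dir r-dir (⋠⇒≢ s₀⋠t) (sameStep-⋠ s₀⋠t₀ s₀⋠t) (sameStep-⋠ t⋠s₀ t⋠s))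
          where
          s₀⋠t : ¬ s₀ ≼ t
          s₀⋠t s₀≼t = y⋠t (≼-trans y≼s₀ s₀≼t)
          s₀⋠t₀ : ¬ s₀ ≼ t₀
          s₀⋠t₀ s₀≼t₀ = y⋠t₀ (≼-trans y≼s₀ s₀≼t₀)
          t⋠s₀ : ¬ t ≼ s₀
          t⋠s₀ t≼s₀ = [ y⋠t , t⋠branch y∈ ] (≼-connex y≼s₀ t≼s₀)

        entering : ∀ {y} → y ∈ root ∷ qs → y ≼ t₀ → ¬ y ≼ s₀ → Interfere T (s ∷ c ∷ l) (s₀ ∷ c₀ ∷ l₀)
        entering {y} y∈ y≼t₀ y⋠s₀ with y ≼? s
        ... | yes y≼s = inj₂ (interferesOn r₀-dir r-dir (≢-sym (⋠⇒≢ t⋠s₀)) (sameStep-subtree y≼t₀ y≼t y⋠s₀)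
                                (sameStep-⋠ t⋠s₀ t⋠s))
          where
          y≼t : y ≼ t
          y≼t = ≼source⇒≼target y∈ y≼s
          t⋠s₀ : ¬ t ≼ s₀
          t⋠s₀ t≼s₀ = y⋠s₀ (≼-trans y≼t t≼s₀)
        ... | no y⋠s = inj₁ (interferesOn r-dir r₀-dir (⋠⇒≢ s⋠t₀) (sameStep-⋠ s⋠t s⋠t₀) (sameStep-⋠ t₀⋠s t₀⋠s₀))
          where
          t₀⋠s : ¬ t₀ ≼ s
          t₀⋠s t₀≼s = y⋠s (≼-trans y≼t₀ t₀≼s)
          t₀⋠s₀ : ¬ t₀ ≼ s₀
          t₀⋠s₀ t₀≼s₀ = y⋠s₀ (≼-trans y≼t₀ t₀≼s₀)
          s⋠t₀ : ¬ s ≼ t₀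
          s⋠t₀ s≼t₀ = [ y⋠s , s⋠branch y∈ ] (≼-connex y≼t₀ s≼t₀)

lemma9 : {n : ℕ} (T : RootedTree n) (q r₀ r : List (V T)) →
    IsBranchPath T q →
    IsRequest T r₀ → (∃[ a ] a ∈ arcs T r₀ × InBranch T q a) →
    IsRequest T r → Unimodal T r → (∀ a → a ∈ arcs T r → ¬ InBranch T q a) →
    Interfere T r r₀
lemma9 T q r₀ []          _ _ _ (_ , no-arc) _ _ = ⊥-elim (no-arc refl)
lemma9 T q r₀ (_ ∷ [])    _ _ _ (_ , no-arc) _ _ = ⊥-elim (no-arc refl)
lemma9 T q []       (_ ∷ _ ∷ _) _ (_ , no-arc) _ _ _ _ = ⊥-elim (no-arc refl)
lemma9 T q (_ ∷ []) (_ ∷ _ ∷ _) _ (_ , no-arc) _ _ _ _ = ⊥-elim (no-arc refl)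
lemma9 T .(RootedTree.root T ∷ qs) (_ ∷ _ ∷ _) (_ ∷ _ ∷ _)
       (q-dir , (qs , refl) , _) (r₀-dir , _) crossing (r-dir , _) unimodal avoids =
  unimodal-interferes T q-dir r-dir avoids r₀-dir crossing unimodal
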